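{- There is an absolute constant $C$ such that for all integers $M\ge2$, all $R$ a power of $2$, and all $\delta\le 1/M^2$, there exists a real polynomial $p$ on $\{ -1,1\}^{M\log_2R}$ of degree at most $C\log_2 R$ that $(1-\delta)$-approximates $\operatorname{ED}_{M,R}$.
   Context: An input $x\in\{ -1,1\}^{M\log_2R}$ is split into $M$ blocks of $\log_2R$ bits, each read in binary as an element of $[R]$, giving $g_x:[M]\to[R]$. $\operatorname{ED}_{M,R}(x)=1$ if $g_x$ is injective and $-1$ otherwise. A real polynomial $p$ on $\{ -1,1\}^n$ $\varepsilon$-approximates a (total) Boolean function $f:\{ -1,1\}^n\to\{ -1,1\}$ if $|p(x)-f(x)|\le\varepsilon$ for all $x\in\{ -1,1\}^n$.
   Formalization: The parameter δ ranges only over the rationals, and the coefficients of the polynomial p are taken in the rationals rather than the reals. -}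

module Defs where

open import Data.Bool using (Bool; true; false; if_then_else_)
open import Data.Nat as ℕ using (ℕ; zero; suc)
open import Data.Fin using (Fin)
open import Data.Vec using (Vec; []; _∷_; lookup; concat)
open import Data.List using (List; map; foldr)
open import Data.List.Relation.Unary.All using (All)
open import Data.Product using (_×_; proj₁; proj₂)
open import Data.Rational using (ℚ; 0ℚ; 1ℚ; -_; _*_; _+_; _-_; _≤_; ∣_∣)
open import Function.Definitions using (Injective)
open import Relation.Binary.PropositionalEquality using (_≡_)
open import Relation.Nullary using (¬_)

-- A point of {-1,1}^n is encoded as a Bool vector: true ↦ -1, false ↦ +1.
pm : Bool → ℚ
pm true  = - 1ℚ
pm false = 1ℚ

-- A set S ⊆ [n] as a characteristic Bool vector.
-- Monomial χ_S(x) = ∏_{i ∈ S} x_i.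
monoEval : ∀ {n} → Vec Bool n → Vec Bool n → ℚ
monoEval []         []       = 1ℚ
monoEval (s ∷ S)    (b ∷ x)  = (if s then pm b else 1ℚ) * monoEval S x

card : ∀ {n} → Vec Bool n → ℕ
card []            = 0
card (true ∷ S)    = suc (card S)
card (false ∷ S)   = card S

-- A real (here: rational) multilinear polynomial on {-1,1}^n:
-- a finite list of (coefficient, monomial set) terms.
Poly : ℕ → Set
Poly n = List (ℚ × Vec Bool n)

eval : ∀ {n} → Poly n → Vec Bool n → ℚ
eval p x = foldr _+_ 0ℚ (map (λ t → proj₁ t * monoEval (proj₂ t) x) p)

DegreeAtMost : ∀ {n} → Poly n → ℕ → Set
DegreeAtMost p d = All (λ t → card (proj₂ t) ℕ.≤ d) p

-- Binary reading of a block of k bits (bit true ↦ 1, most significant first),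
-- giving an element of [2^k] (as a natural < 2^k).
bin : ∀ {k} → Vec Bool k → ℕ
bin {zero}  []      = 0
bin {suc k} (b ∷ v) = (if b then 2 ℕ.^ k else 0) ℕ.+ bin v

-- g_x : [M] → [R] for x given blockwise (x = concat xs).
g : ∀ {M k} → Vec (Vec Bool k) M → Fin M → ℕ
g xs i = bin (lookup xs i)

-- ED_{M,R}(x) = 1 if g_x injective, -1 otherwise; the statement
-- "|p(x) - ED(x)| ≤ ε" is spelled out by cases.
ApproxED : ∀ {M k} → Poly (M ℕ.* k) → ℚ → Set
ApproxED {M} {k} p ε = (xs : Vec (Vec Bool k) M) →
    (Injective _≡_ _≡_ (g xs) → ∣ eval p (concat xs) - 1ℚ ∣ ≤ ε)
  × (¬ Injective _≡_ _≡_ (g xs) → ∣ eval p (concat xs) - (- 1ℚ) ∣ ≤ ε)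

-- ED(x) = 1 iff no two distinct blocks of x coincide. Equality of two k-bit blocks
-- xᵢ, xⱼ is the degree-2k polynomial ∏ₜ (1 + xᵢₜ xⱼₜ)/2, so the number N of ordered
-- pairs i ≠ j of colliding blocks is a polynomial of degree 2k with N = 0 on injective
-- inputs and 1 ≤ N ≤ M² otherwise. For 0 ≤ δ ≤ 1/M² the polynomial δ − 2δN then equals δ
-- on injective inputs and lies in [δ − 2, −δ] on the others: it (1 − δ)-approximates ED.
-- For δ ≤ 0 the zero polynomial, with error 1 ≤ 1 − δ, suffices. Hence C = 2.
module Submission where

open import Defs
open import Data.Nat using (ℕ; _^_)
open import Data.Nat as ℕ using ()
open import Data.Integer using (+_)
open import Data.Rational using (ℚ; 1ℚ; _/_; _*_; _-_; _≤_)
open import Data.Product using (∃-syntax; _×_)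

open import Data.Bool as Bool using (Bool; true; false; _xor_; if_then_else_)
open import Data.Empty using (⊥-elim)
import Data.Integer as ℤ
import Data.Integer.Properties as ℤₚ
open import Data.Fin as Fin using (Fin)
open import Data.List as List
  using (List; []; _∷_; map; filter; concatMap; cartesianProduct; allFin; length)
open import Data.List.Membership.Propositional using (_∈_)
open import Data.List.Membership.Propositional.Properties
  using (∈-filter⁺; ∈-filter⁻; ∈-cartesianProduct⁺; ∈-allFin; ∉[])
import Data.List.Properties as List
open import Data.List.Relation.Unary.All as All using (_∷_)
import Data.List.Relation.Unary.All.Properties as All
open import Data.Nat.Divisibility using (∣1⇒≡1)
import Data.Nat.Properties as ℕₚ
open import Data.Product using (_,_; proj₁; proj₂)
open import Data.Rational using (0ℚ; ½; -_; _+_; ∣_∣; mkℚ; *≤*; nonNegative)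
open import Data.Rational.Properties
open import Data.Rational.Solver using (module +-*-Solver)
open import Data.Sum using (inj₁; inj₂)
open import Data.Vec as Vec using (Vec; []; _∷_; lookup; concat; _++_; replicate; zipWith)
import Data.Vec.Properties as Vec
open import Function.Base as Function using (_∘_)
open import Function.Definitions using (Injective)
open import Relation.Binary.PropositionalEquality
open import Relation.Nullary using (¬_; Dec; yes; no; ¬?)
open import Relation.Unary using (Pred; Decidable)

open +-*-Solver
open ≡-Reasoning

private
  variable
    k m n M : ℕ

falses : ∀ n → Vec Bool n
falses n = replicate n false

-- On masks this is symmetric difference; on points of {-1,1}ⁿ it is the coordinatewise product.
_⊕_ : Vec Bool n → Vec Bool n → Vec Bool n
_⊕_ = zipWith _xor_

⊕-self : (x : Vec Bool n) → x ⊕ x ≡ falses n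
⊕-self []          = refl
⊕-self (true ∷ x)  = cong (false ∷_) (⊕-self x)
⊕-self (false ∷ x) = cong (false ∷_) (⊕-self x)

⊕≡falses⇒≡ : (x y : Vec Bool n) → x ⊕ y ≡ falses n → x ≡ y
⊕≡falses⇒≡ []          []          _ = refl
⊕≡falses⇒≡ (true ∷ x)  (true ∷ y)  e = cong (true ∷_) (⊕≡falses⇒≡ x y (Vec.∷-injectiveʳ e))
⊕≡falses⇒≡ (false ∷ x) (false ∷ y) e = cong (false ∷_) (⊕≡falses⇒≡ x y (Vec.∷-injectiveʳ e))
⊕≡falses⇒≡ (true ∷ x)  (false ∷ y) ()
⊕≡falses⇒≡ (false ∷ x) (true ∷ y)  ()

*-interchange : ∀ a b c d → (a * b) * (c * d) ≡ (a * c) * (b * d)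
*-interchange = solve 4 (λ a b c d → (a :* b) :* (c :* d) := (a :* c) :* (b :* d)) refl

factor : Bool → Bool → ℚ
factor s b = if s then pm b else 1ℚ

monoEval-++ : (S : Vec Bool m) (T : Vec Bool n) (x : Vec Bool m) (y : Vec Bool n) →
              monoEval (S ++ T) (x ++ y) ≡ monoEval S x * monoEval T y
monoEval-++ []      T []      y = sym (*-identityˡ _)
monoEval-++ (s ∷ S) T (b ∷ x) y =
  trans (cong (factor s b *_) (monoEval-++ S T x y))
        (sym (*-assoc (factor s b) (monoEval S x) (monoEval T y)))

monoEval-falses : (x : Vec Bool n) → monoEval (falses n) x ≡ 1ℚ
monoEval-falses []      = refl
monoEval-falses (b ∷ x) = trans (*-identityˡ _) (monoEval-falses x)

monoEval-⊕ˡ : (S T x : Vec Bool n) → monoEval (S ⊕ T) x ≡ monoEval S x * monoEval T x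
monoEval-⊕ˡ []      []      []      = refl
monoEval-⊕ˡ (s ∷ S) (t ∷ T) (b ∷ x) =
  trans (cong₂ _*_ (factor-xorˡ s t b) (monoEval-⊕ˡ S T x))
        (*-interchange (factor s b) (factor t b) (monoEval S x) (monoEval T x))
  where
  factor-xorˡ : ∀ s t b → factor (s xor t) b ≡ factor s b * factor t b
  factor-xorˡ true  true  true  = refl
  factor-xorˡ true  true  false = refl
  factor-xorˡ true  false b     = sym (*-identityʳ _)
  factor-xorˡ false t     b     = sym (*-identityˡ _)

monoEval-⊕ʳ : (S x y : Vec Bool n) → monoEval S (x ⊕ y) ≡ monoEval S x * monoEval S y
monoEval-⊕ʳ []      []      []      = refl
monoEval-⊕ʳ (s ∷ S) (a ∷ x) (b ∷ y) =
  trans (cong₂ _*_ (factor-xorʳ s a b) (monoEval-⊕ʳ S x y))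
        (*-interchange (factor s a) (factor s b) (monoEval S x) (monoEval S y))
  where
  factor-xorʳ : ∀ s a b → factor s (a xor b) ≡ factor s a * factor s b
  factor-xorʳ true  true  true  = refl
  factor-xorʳ true  true  false = refl
  factor-xorʳ true  false true  = refl
  factor-xorʳ true  false false = refl
  factor-xorʳ false a     b     = refl

card-++ : (S : Vec Bool m) (T : Vec Bool n) → card (S ++ T) ≡ card S ℕ.+ card T
card-++ []          T = refl
card-++ (true ∷ S)  T = cong ℕ.suc (card-++ S T)
card-++ (false ∷ S) T = card-++ S T

card-falses : ∀ n → card (falses n) ≡ 0
card-falses ℕ.zero    = refl
card-falses (ℕ.suc n) = card-falses n

card≤length : (S : Vec Bool n) → card S ℕ.≤ n
card≤length []          = ℕ.z≤n
card≤length (true ∷ S)  = ℕ.s≤s (card≤length S)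
card≤length (false ∷ S) = ℕₚ.m≤n⇒m≤1+n (card≤length S)

card-⊕ : (S T : Vec Bool n) → card (S ⊕ T) ℕ.≤ card S ℕ.+ card T
card-⊕ []          []          = ℕ.z≤n
card-⊕ (true ∷ S)  (true ∷ T)  =
  ℕₚ.≤-trans (card-⊕ S T) (ℕₚ.m≤n⇒m≤1+n (ℕₚ.+-monoʳ-≤ (card S) (ℕₚ.n≤1+n (card T))))
card-⊕ (true ∷ S)  (false ∷ T) = ℕ.s≤s (card-⊕ S T)
card-⊕ (false ∷ S) (true ∷ T)  =
  ℕₚ.≤-trans (ℕ.s≤s (card-⊕ S T)) (ℕₚ.≤-reflexive (sym (ℕₚ.+-suc (card S) (card T))))
card-⊕ (false ∷ S) (false ∷ T) = card-⊕ S T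

term : Vec Bool n → ℚ × Vec Bool n → ℚ
term x t = proj₁ t * monoEval (proj₂ t) x

eval-++ : (p q : Poly n) (x : Vec Bool n) → eval (p List.++ q) x ≡ eval p x + eval q x
eval-++ []      q x = sym (+-identityˡ _)
eval-++ (t ∷ p) q x =
  trans (cong (_+_ (term x t)) (eval-++ p q x)) (sym (+-assoc (term x t) (eval p x) (eval q x)))

eval-map : (f : ℚ × Vec Bool m → ℚ × Vec Bool n) (r : ℚ) {x : Vec Bool m} {y : Vec Bool n} →
           (∀ t → term y (f t) ≡ r * term x t) → (p : Poly m) → eval (map f p) y ≡ r * eval p x
eval-map f r hyp []      = sym (*-zeroʳ r)
eval-map f r {x} hyp (t ∷ p) =
  trans (cong₂ _+_ (hyp t) (eval-map f r hyp p)) (sym (*-distribˡ-+ r (term x t) (eval p x)))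

blockMask : Fin M → Vec Bool k → Vec Bool (M ℕ.* k)
blockMask {ℕ.suc M} {k} Fin.zero    S = S ++ falses (M ℕ.* k)
blockMask {ℕ.suc M} {k} (Fin.suc i) S = falses k ++ blockMask i S

monoEval-blockMask : (i : Fin M) (S : Vec Bool k) (xs : Vec (Vec Bool k) M) →
                     monoEval (blockMask i S) (concat xs) ≡ monoEval S (lookup xs i)
monoEval-blockMask Fin.zero S (x ∷ xs) = begin
  monoEval (S ++ falses _) (x ++ concat xs)       ≡⟨ monoEval-++ S (falses _) x (concat xs) ⟩
  monoEval S x * monoEval (falses _) (concat xs)  ≡⟨ cong (monoEval S x *_) (monoEval-falses (concat xs)) ⟩
  monoEval S x * 1ℚ                               ≡⟨ *-identityʳ _ ⟩
  monoEval S x                                    ∎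
monoEval-blockMask {k = k} (Fin.suc i) S (x ∷ xs) = begin
  monoEval (falses k ++ blockMask i S) (x ++ concat xs)
    ≡⟨ monoEval-++ (falses k) (blockMask i S) x (concat xs) ⟩
  monoEval (falses k) x * monoEval (blockMask i S) (concat xs)
    ≡⟨ cong₂ _*_ (monoEval-falses x) (monoEval-blockMask i S xs) ⟩
  1ℚ * monoEval S (lookup xs i)
    ≡⟨ *-identityˡ _ ⟩
  monoEval S (lookup xs i) ∎

card-blockMask : (i : Fin M) (S : Vec Bool k) → card (blockMask i S) ≡ card S
card-blockMask {ℕ.suc M} {k} Fin.zero S = begin
  card (S ++ falses (M ℕ.* k))           ≡⟨ card-++ S (falses (M ℕ.* k)) ⟩
  card S ℕ.+ card (falses (M ℕ.* k))     ≡⟨ cong (card S ℕ.+_) (card-falses (M ℕ.* k)) ⟩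
  card S ℕ.+ 0                           ≡⟨ ℕₚ.+-identityʳ (card S) ⟩
  card S                                 ∎
card-blockMask {k = k} (Fin.suc i) S = begin
  card (falses k ++ blockMask i S)          ≡⟨ card-++ (falses k) (blockMask i S) ⟩
  card (falses k) ℕ.+ card (blockMask i S)  ≡⟨ cong₂ ℕ._+_ (card-falses k) (card-blockMask i S) ⟩
  card S                                    ∎

-- ∏ᵢ (1 + xᵢ)/2, the indicator of the point (1, …, 1), i.e. of falses.
falsesIndicator : ∀ k → Poly k
falsesIndicator ℕ.zero    = (1ℚ , []) ∷ []
falsesIndicator (ℕ.suc k) = map (λ (c , S) → (½ * c , false ∷ S)) (falsesIndicator k)
                   List.++ map (λ (c , S) → (½ * c , true ∷ S)) (falsesIndicator k)

eval-falsesIndicator-∷ : (b : Bool) (z : Vec Bool k) →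
  eval (falsesIndicator (ℕ.suc k)) (b ∷ z) ≡ (½ + ½ * pm b) * eval (falsesIndicator k) z
eval-falsesIndicator-∷ {k} b z = begin
  eval (map lift₀ F List.++ map lift₁ F) (b ∷ z)
    ≡⟨ eval-++ (map lift₀ F) (map lift₁ F) (b ∷ z) ⟩
  eval (map lift₀ F) (b ∷ z) + eval (map lift₁ F) (b ∷ z)
    ≡⟨ cong₂ _+_ (eval-map lift₀ ½ (λ (c , S) → rearrange ½ c 1ℚ (monoEval S z)) F)
                 (eval-map lift₁ (½ * pm b) (λ (c , S) → rearrange ½ c (pm b) (monoEval S z)) F) ⟩
  ½ * eval F z + (½ * pm b) * eval F z
    ≡⟨ sym (*-distribʳ-+ (eval F z) ½ (½ * pm b)) ⟩
  (½ + ½ * pm b) * eval F z ∎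
  where
  F = falsesIndicator k
  lift₀ lift₁ : ℚ × Vec Bool k → ℚ × Vec Bool (ℕ.suc k)
  lift₀ (c , S) = (½ * c , false ∷ S)
  lift₁ (c , S) = (½ * c , true ∷ S)
  rearrange : ∀ h c a e → (h * c) * (a * e) ≡ (h * a) * (c * e)
  rearrange = solve 4 (λ h c a e → (h :* c) :* (a :* e) := (h :* a) :* (c :* e)) refl

eval-falsesIndicator-falses : ∀ k → eval (falsesIndicator k) (falses k) ≡ 1ℚ
eval-falsesIndicator-falses ℕ.zero    = refl
eval-falsesIndicator-falses (ℕ.suc k) =
  trans (eval-falsesIndicator-∷ false (falses k)) (cong (1ℚ *_) (eval-falsesIndicator-falses k))

eval-falsesIndicator-≢ : (z : Vec Bool k) → z ≢ falses k → eval (falsesIndicator k) z ≡ 0ℚ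
eval-falsesIndicator-≢ []          z≢ = ⊥-elim (z≢ refl)
eval-falsesIndicator-≢ (true ∷ z)  _  =
  trans (eval-falsesIndicator-∷ true z) (*-zeroˡ (eval (falsesIndicator _) z))
eval-falsesIndicator-≢ (false ∷ z) z≢ =
  trans (eval-falsesIndicator-∷ false z)
        (trans (*-identityˡ _) (eval-falsesIndicator-≢ z (λ z≡ → z≢ (cong (false ∷_) z≡))))

-- Σ_S 2⁻ᵏ χ_S(xᵢ) χ_S(xⱼ) = ∏ₜ (1 + xᵢₜ xⱼₜ)/2, i.e. falsesIndicator k at xᵢ ⊕ xⱼ.
equalBlocks : Fin M → Fin M → Poly (M ℕ.* k)
equalBlocks {k = k} i j = map (λ (c , S) → (c , blockMask i S ⊕ blockMask j S)) (falsesIndicator k)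

eval-equalBlocks : (i j : Fin M) (xs : Vec (Vec Bool k) M) →
  eval (equalBlocks i j) (concat xs) ≡ eval (falsesIndicator k) (lookup xs i ⊕ lookup xs j)
eval-equalBlocks {k = k} i j xs =
  trans (eval-map _ 1ℚ (λ (c , S) → trans (cong (c *_) (monoEval-pair S)) (sym (*-identityˡ _)))
                  (falsesIndicator k))
        (*-identityˡ _)
  where
  monoEval-pair : ∀ S → monoEval (blockMask i S ⊕ blockMask j S) (concat xs)
                        ≡ monoEval S (lookup xs i ⊕ lookup xs j)
  monoEval-pair S = begin
    monoEval (blockMask i S ⊕ blockMask j S) (concat xs)
      ≡⟨ monoEval-⊕ˡ (blockMask i S) (blockMask j S) (concat xs) ⟩
    monoEval (blockMask i S) (concat xs) * monoEval (blockMask j S) (concat xs)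
      ≡⟨ cong₂ _*_ (monoEval-blockMask i S xs) (monoEval-blockMask j S xs) ⟩
    monoEval S (lookup xs i) * monoEval S (lookup xs j)
      ≡⟨ monoEval-⊕ʳ S (lookup xs i) (lookup xs j) ⟨
    monoEval S (lookup xs i ⊕ lookup xs j) ∎

eval-equalBlocks-≡ : (i j : Fin M) (xs : Vec (Vec Bool k) M) →
  lookup xs i ≡ lookup xs j → eval (equalBlocks i j) (concat xs) ≡ 1ℚ
eval-equalBlocks-≡ {k = k} i j xs e = begin
  eval (equalBlocks i j) (concat xs)                    ≡⟨ eval-equalBlocks i j xs ⟩
  eval (falsesIndicator k) (lookup xs i ⊕ lookup xs j)  ≡⟨ cong (λ y → eval (falsesIndicator k) (_ ⊕ y)) e ⟨
  eval (falsesIndicator k) (lookup xs i ⊕ lookup xs i)  ≡⟨ cong (eval (falsesIndicator k)) (⊕-self _) ⟩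
  eval (falsesIndicator k) (falses k)                   ≡⟨ eval-falsesIndicator-falses k ⟩
  1ℚ                                                    ∎

eval-equalBlocks-≢ : (i j : Fin M) (xs : Vec (Vec Bool k) M) →
  lookup xs i ≢ lookup xs j → eval (equalBlocks i j) (concat xs) ≡ 0ℚ
eval-equalBlocks-≢ i j xs ne =
  trans (eval-equalBlocks i j xs)
        (eval-falsesIndicator-≢ _ (λ e → ne (⊕≡falses⇒≡ (lookup xs i) (lookup xs j) e)))

degree-equalBlocks : (i j : Fin M) → DegreeAtMost (equalBlocks {k = k} i j) (k ℕ.+ k)
degree-equalBlocks {k = k} i j = All.map⁺ (All.universal card-bound (falsesIndicator k))
  where
  card-bound : (t : ℚ × Vec Bool k) →
               card (blockMask i (proj₂ t) ⊕ blockMask j (proj₂ t)) ℕ.≤ k ℕ.+ k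
  card-bound (_ , S) = ℕₚ.≤-trans (card-⊕ (blockMask i S) (blockMask j S))
    (ℕₚ.≤-trans (ℕₚ.≤-reflexive (cong₂ ℕ._+_ (card-blockMask i S) (card-blockMask j S)))
                (ℕₚ.+-mono-≤ (card≤length S) (card≤length S)))

bin-< : (v : Vec Bool k) → bin v ℕ.< 2 ^ k
bin-< []                 = ℕ.s≤s ℕ.z≤n
bin-< {ℕ.suc k} (true ∷ v)  =
  subst (λ r → 2 ^ k ℕ.+ bin v ℕ.< 2 ^ k ℕ.+ r) (sym (ℕₚ.+-identityʳ (2 ^ k)))
        (ℕₚ.+-monoʳ-< (2 ^ k) (bin-< v))
bin-< {ℕ.suc k} (false ∷ v) = ℕₚ.<-≤-trans (bin-< v) (ℕₚ.m≤m+n (2 ^ k) (2 ^ k ℕ.+ 0))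

2^k+bin≢bin : (u v : Vec Bool k) → 2 ^ k ℕ.+ bin u ≢ bin v
2^k+bin≢bin {k} u v e =
  ℕₚ.<-irrefl refl (ℕₚ.≤-<-trans (subst (2 ^ k ℕ.≤_) e (ℕₚ.m≤m+n (2 ^ k) (bin u))) (bin-< v))

bin-injective : (u v : Vec Bool k) → bin u ≡ bin v → u ≡ v
bin-injective []          []          _ = refl
bin-injective {ℕ.suc k} (true ∷ u) (true ∷ v) e =
  cong (true ∷_) (bin-injective u v (ℕₚ.+-cancelˡ-≡ (2 ^ k) _ _ e))
bin-injective (false ∷ u) (false ∷ v) e = cong (false ∷_) (bin-injective u v e)
bin-injective (true ∷ u)  (false ∷ v) e = ⊥-elim (2^k+bin≢bin u v e)
bin-injective (false ∷ u) (true ∷ v)  e = ⊥-elim (2^k+bin≢bin v u (sym e))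

length-cartesianProduct : ∀ {A B : Set} (xs : List A) (ys : List B) →
                          length (cartesianProduct xs ys) ≡ length xs ℕ.* length ys
length-cartesianProduct []       ys = refl
length-cartesianProduct (x ∷ xs) ys = begin
  length (map (x ,_) ys List.++ cartesianProduct xs ys)
    ≡⟨ List.length-++ (map (x ,_) ys) ⟩
  length (map (x ,_) ys) ℕ.+ length (cartesianProduct xs ys)
    ≡⟨ cong₂ ℕ._+_ (List.length-map (x ,_) ys) (length-cartesianProduct xs ys) ⟩
  length ys ℕ.+ length xs ℕ.* length ys ∎

Distinct : Pred (Fin M × Fin M) _
Distinct (i , j) = i ≢ j

distinct? : Decidable (Distinct {M})
distinct? (i , j) = ¬? (i Fin.≟ j)

distinctPairs : ∀ M → List (Fin M × Fin M)
distinctPairs M = filter distinct? (cartesianProduct (allFin M) (allFin M))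

∈-distinctPairs⁺ : {i j : Fin M} → i ≢ j → (i , j) ∈ distinctPairs M
∈-distinctPairs⁺ {i = i} {j} = ∈-filter⁺ distinct? (∈-cartesianProduct⁺ (∈-allFin i) (∈-allFin j))

∈-distinctPairs⁻ : {ij : Fin M × Fin M} → ij ∈ distinctPairs M → Distinct ij
∈-distinctPairs⁻ {M} = proj₂ ∘ ∈-filter⁻ distinct? {xs = cartesianProduct (allFin M) (allFin M)}

length-distinctPairs : ∀ M → length (distinctPairs M) ℕ.≤ M ℕ.* M
length-distinctPairs M =
  ℕₚ.≤-trans (List.length-filter distinct? (cartesianProduct (allFin M) (allFin M))) (ℕₚ.≤-reflexive (trans (length-cartesianProduct (allFin M) (allFin M))
                         (cong₂ ℕ._*_ (length-allFin M) (length-allFin M))))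
  where
  length-allFin : ∀ M → length (allFin M) ≡ M
  length-allFin M = List.length-tabulate {n = M} Function.id

Collides : Vec (Vec Bool k) M → Pred (Fin M × Fin M) _
Collides xs (i , j) = lookup xs i ≡ lookup xs j

collides? : (xs : Vec (Vec Bool k) M) → Decidable (Collides xs)
collides? xs (i , j) = Vec.≡-dec Bool._≟_ (lookup xs i) (lookup xs j)

collisions : Vec (Vec Bool k) M → List (Fin M × Fin M)
collisions {M = M} xs = filter (collides? xs) (distinctPairs M)

injective⇒collisions≡[] : (xs : Vec (Vec Bool k) M) →
                          Injective _≡_ _≡_ (g xs) → collisions xs ≡ []
injective⇒collisions≡[] xs inj = List.filter-none (collides? xs) (All.tabulate no-collision)
  where
  no-collision : ∀ {ij} → ij ∈ distinctPairs _ → ¬ Collides xs ij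
  no-collision {i , j} ij∈ e = ∈-distinctPairs⁻ ij∈ (inj (cong bin e))

collisions≡[]⇒injective : (xs : Vec (Vec Bool k) M) →
                          collisions xs ≡ [] → Injective _≡_ _≡_ (g xs)
collisions≡[]⇒injective xs none {i} {j} gᵢ≡gⱼ with i Fin.≟ j
... | yes i≡j = i≡j
... | no  i≢j = ⊥-elim (∉[] (subst ((i , j) ∈_) none
                  (∈-filter⁺ (collides? xs) (∈-distinctPairs⁺ i≢j) (bin-injective _ _ gᵢ≡gⱼ))))

fromℕ : ℕ → ℚ
fromℕ n = + n / 1

fromℕ≡mkℚ : ∀ n → fromℕ n ≡ mkℚ (+ n) 0 (λ p → ∣1⇒≡1 (proj₂ p))
fromℕ≡mkℚ n = normalize-coprime (λ p → ∣1⇒≡1 (proj₂ p))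

fromℕ-+ : ∀ m n → fromℕ (m ℕ.+ n) ≡ fromℕ m + fromℕ n
fromℕ-+ m n rewrite fromℕ≡mkℚ m | fromℕ≡mkℚ n =
  cong (_/ 1) (sym (cong₂ ℤ._+_ (ℤₚ.*-identityʳ (+ m)) (ℤₚ.*-identityʳ (+ n))))

fromℕ-mono-≤ : ∀ {m n} → m ℕ.≤ n → fromℕ m ≤ fromℕ n
fromℕ-mono-≤ {m} {n} m≤n rewrite fromℕ≡mkℚ m | fromℕ≡mkℚ n =
  *≤* (subst₂ ℤ._≤_ (sym (ℤₚ.*-identityʳ (+ m))) (sym (ℤₚ.*-identityʳ (+ n)))
              (ℤ.+≤+ m≤n))

collisionPolyOn : List (Fin M × Fin M) → Poly (M ℕ.* k)
collisionPolyOn = concatMap (λ (i , j) → equalBlocks i j)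

eval-collisionPolyOn : (xs : Vec (Vec Bool k) M) (L : List (Fin M × Fin M)) →
  eval (collisionPolyOn L) (concat xs) ≡ fromℕ (length (filter (collides? xs) L))
eval-collisionPolyOn xs []            = refl
eval-collisionPolyOn xs ((i , j) ∷ L) = begin
  eval (equalBlocks i j List.++ collisionPolyOn L) (concat xs)
    ≡⟨ eval-++ (equalBlocks i j) (collisionPolyOn L) (concat xs) ⟩
  eval (equalBlocks i j) (concat xs) + eval (collisionPolyOn L) (concat xs)
    ≡⟨ cong (_+_ (eval (equalBlocks i j) (concat xs))) (eval-collisionPolyOn xs L) ⟩
  eval (equalBlocks i j) (concat xs) + fromℕ (length (filter (collides? xs) L))
    ≡⟨ count-head (collides? xs (i , j)) ⟩
  fromℕ (length (filter (collides? xs) ((i , j) ∷ L))) ∎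
  where
  count-head : Dec (Collides xs (i , j)) →
    eval (equalBlocks i j) (concat xs) + fromℕ (length (filter (collides? xs) L))
      ≡ fromℕ (length (filter (collides? xs) ((i , j) ∷ L)))
  count-head (yes e) = begin
    eval (equalBlocks i j) (concat xs) + fromℕ (length (filter (collides? xs) L))
      ≡⟨ cong (_+ fromℕ (length (filter (collides? xs) L))) (eval-equalBlocks-≡ i j xs e) ⟩
    1ℚ + fromℕ (length (filter (collides? xs) L))
      ≡⟨ fromℕ-+ 1 (length (filter (collides? xs) L)) ⟨
    fromℕ (length ((i , j) ∷ filter (collides? xs) L))
      ≡⟨ cong (fromℕ ∘ length) (List.filter-accept (collides? xs) e) ⟨
    fromℕ (length (filter (collides? xs) ((i , j) ∷ L))) ∎
  count-head (no ne) = begin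
    eval (equalBlocks i j) (concat xs) + fromℕ (length (filter (collides? xs) L))
      ≡⟨ cong (_+ fromℕ (length (filter (collides? xs) L))) (eval-equalBlocks-≢ i j xs ne) ⟩
    0ℚ + fromℕ (length (filter (collides? xs) L))
      ≡⟨ +-identityˡ _ ⟩
    fromℕ (length (filter (collides? xs) L))
      ≡⟨ cong (fromℕ ∘ length) (List.filter-reject (collides? xs) ne) ⟨
    fromℕ (length (filter (collides? xs) ((i , j) ∷ L))) ∎

degree-collisionPolyOn : (L : List (Fin M × Fin M)) →
                         DegreeAtMost (collisionPolyOn {k = k} L) (k ℕ.+ k)
degree-collisionPolyOn L =
  All.concat⁺ (All.map⁺ (All.universal (λ (i , j) → degree-equalBlocks i j) L))

non-injective⇒collision : (xs : Vec (Vec Bool k) M) →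
                          ¬ Injective _≡_ _≡_ (g xs) → 1 ℕ.≤ length (collisions xs)
non-injective⇒collision xs ¬inj with collisions xs in none
... | []    = ⊥-elim (¬inj (collisions≡[]⇒injective xs none))
... | _ ∷ _ = ℕ.s≤s ℕ.z≤n

length-collisions : (xs : Vec (Vec Bool k) M) → length (collisions xs) ℕ.≤ M ℕ.* M
length-collisions {M = M} xs =
  ℕₚ.≤-trans (List.length-filter (collides? xs) (distinctPairs M)) (length-distinctPairs M)

edPoly : ∀ M k → ℚ → Poly (M ℕ.* k)
edPoly M k δ =
  (δ , falses _) ∷ map (λ (c , S) → (- (δ + δ) * c , S)) (collisionPolyOn (distinctPairs M))

eval-edPoly : (δ : ℚ) (xs : Vec (Vec Bool k) M) →
  eval (edPoly M k δ) (concat xs) ≡ δ + - (δ + δ) * fromℕ (length (collisions xs))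
eval-edPoly {M = M} δ xs = cong₂ _+_
  (trans (cong (δ *_) (monoEval-falses (concat xs))) (*-identityʳ δ))
  (trans (eval-map _ (- (δ + δ)) (λ (c , S) → *-assoc (- (δ + δ)) c (monoEval S (concat xs)))
                  (collisionPolyOn (distinctPairs M)))
         (cong (- (δ + δ) *_) (eval-collisionPolyOn xs (distinctPairs M))))

degree-edPoly : ∀ M k (δ : ℚ) → DegreeAtMost (edPoly M k δ) (2 ℕ.* k)
degree-edPoly M k δ =
  subst (ℕ._≤ 2 ℕ.* k) (sym (card-falses (M ℕ.* k))) ℕ.z≤n
  ∷ All.map⁺ (All.map (λ h → ℕₚ.≤-trans h k+k≤2k) (degree-collisionPolyOn (distinctPairs M)))
  where
  k+k≤2k : k ℕ.+ k ℕ.≤ 2 ℕ.* k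
  k+k≤2k = ℕₚ.≤-reflexive (cong (k ℕ.+_) (sym (ℕₚ.+-identityʳ k)))

p≤q⇒0≤q-p : ∀ {p q} → p ≤ q → 0ℚ ≤ q - p
p≤q⇒0≤q-p {p} {q} p≤q = subst (_≤ q - p) (+-inverseʳ p) (+-monoˡ-≤ (- p) p≤q)

0≤q-p⇒p≤q : ∀ {p q} → 0ℚ ≤ q - p → p ≤ q
0≤q-p⇒p≤q {p} {q} h = subst₂ _≤_ (+-identityʳ p) (p+[q-p]≡q p q) (+-monoʳ-≤ p h)
  where
  p+[q-p]≡q : ∀ p q → p + (q - p) ≡ q
  p+[q-p]≡q = solve 2 (λ p q → p :+ (q :- p) := q) refl

-e≤x≤e⇒∣x∣≤e : ∀ {x e} → - e ≤ x → x ≤ e → ∣ x ∣ ≤ e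
-e≤x≤e⇒∣x∣≤e {x} {e} -e≤x x≤e with ∣p∣≡p∨∣p∣≡-p x
... | inj₁ ∣x∣≡x  = subst (_≤ e) (sym ∣x∣≡x) x≤e
... | inj₂ ∣x∣≡-x = subst₂ _≤_ (sym ∣x∣≡-x) (neg-involutive e) (neg-antimono-≤ -e≤x)
  where
  neg-involutive : ∀ e → - - e ≡ e
  neg-involutive = solve 1 (λ e → :- (:- e) := e) refl

error-injective : ∀ {δ} → δ ≤ 1ℚ → ∣ (δ + - (δ + δ) * 0ℚ) - 1ℚ ∣ ≤ 1ℚ - δ
error-injective {δ} δ≤1 = ≤-reflexive (begin
  ∣ (δ + - (δ + δ) * 0ℚ) - 1ℚ ∣ ≡⟨ cong ∣_∣ (shape δ) ⟩
  ∣ - (1ℚ - δ) ∣                 ≡⟨ ∣-p∣≡∣p∣ (1ℚ - δ) ⟩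
  ∣ 1ℚ - δ ∣                     ≡⟨ 0≤p⇒∣p∣≡p (p≤q⇒0≤q-p δ≤1) ⟩
  1ℚ - δ                         ∎)
  where
  shape : ∀ δ → (δ + - (δ + δ) * 0ℚ) - 1ℚ ≡ - (1ℚ - δ)
  shape = solve 1 (λ δ → (δ :+ :- (δ :+ δ) :* con 0ℚ) :- con 1ℚ := :- (con 1ℚ :- δ)) refl

error-collision : ∀ {δ N} → 0ℚ ≤ δ → 1ℚ ≤ N → δ * N ≤ 1ℚ →
                  ∣ (δ + - (δ + δ) * N) - - 1ℚ ∣ ≤ 1ℚ - δ
error-collision {δ} {N} 0≤δ 1≤N δN≤1 = -e≤x≤e⇒∣x∣≤e
  (0≤q-p⇒p≤q (subst (0ℚ ≤_) (sym (lower-gap δ N))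
    (+-mono-≤ (p≤q⇒0≤q-p δN≤1) (p≤q⇒0≤q-p δN≤1))))
  (0≤q-p⇒p≤q (subst (0ℚ ≤_) (sym (upper-gap δ N))
    (subst (_≤ (δ + δ) * (N - 1ℚ)) (*-zeroʳ (δ + δ))
      (*-monoˡ-≤-nonNeg (δ + δ) {{nonNegative (+-mono-≤ 0≤δ 0≤δ)}} (p≤q⇒0≤q-p 1≤N)))))
  where
  lower-gap : ∀ δ N → ((δ + - (δ + δ) * N) - - 1ℚ) - - (1ℚ - δ)
                      ≡ (1ℚ - δ * N) + (1ℚ - δ * N)
  lower-gap = solve 2 (λ δ N → ((δ :+ :- (δ :+ δ) :* N) :- :- con 1ℚ) :- :- (con 1ℚ :- δ)
                              := (con 1ℚ :- δ :* N) :+ (con 1ℚ :- δ :* N)) refl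
  upper-gap : ∀ δ N → (1ℚ - δ) - ((δ + - (δ + δ) * N) - - 1ℚ) ≡ (δ + δ) * (N - 1ℚ)
  upper-gap = solve 2 (λ δ N → (con 1ℚ :- δ) :- ((δ :+ :- (δ :+ δ) :* N) :- :- con 1ℚ)
                              := (δ :+ δ) :* (N :- con 1ℚ)) refl

edPoly-approximates : ∀ {M k δ} → 1 ℕ.≤ M → 0ℚ ≤ δ → δ * fromℕ (M ℕ.* M) ≤ 1ℚ →
                      ApproxED {M} {k} (edPoly M k δ) (1ℚ - δ)
edPoly-approximates {M} {k} {δ} 1≤M 0≤δ δM²≤1 xs = on-injective , on-non-injective
  where
  δ*-mono : ∀ {a b} → a ≤ b → δ * a ≤ δ * b
  δ*-mono = *-monoˡ-≤-nonNeg δ {{nonNegative 0≤δ}}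

  δ≤1 : δ ≤ 1ℚ
  δ≤1 = ≤-trans (subst (_≤ δ * fromℕ (M ℕ.* M)) (*-identityʳ δ)
                       (δ*-mono (fromℕ-mono-≤ (ℕₚ.*-mono-≤ 1≤M 1≤M))))
                δM²≤1

  on-injective : Injective _≡_ _≡_ (g xs) → ∣ eval (edPoly M k δ) (concat xs) - 1ℚ ∣ ≤ 1ℚ - δ
  on-injective inj = subst (λ v → ∣ v - 1ℚ ∣ ≤ 1ℚ - δ) (sym eval≡δ) (error-injective δ≤1)
    where
    eval≡δ : eval (edPoly M k δ) (concat xs) ≡ δ + - (δ + δ) * 0ℚ
    eval≡δ = trans (eval-edPoly δ xs)
                   (cong (λ cs → δ + - (δ + δ) * fromℕ (length cs)) (injective⇒collisions≡[] xs inj))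

  on-non-injective : ¬ Injective _≡_ _≡_ (g xs) → ∣ eval (edPoly M k δ) (concat xs) - - 1ℚ ∣ ≤ 1ℚ - δ
  on-non-injective ¬inj = subst (λ v → ∣ v - - 1ℚ ∣ ≤ 1ℚ - δ) (sym (eval-edPoly δ xs))
    (error-collision 0≤δ (fromℕ-mono-≤ (non-injective⇒collision xs ¬inj))
                         (≤-trans (δ*-mono (fromℕ-mono-≤ (length-collisions xs))) δM²≤1))

zeroPoly-approximates : ∀ {M k δ} → δ ≤ 0ℚ → ApproxED {M} {k} [] (1ℚ - δ)
zeroPoly-approximates {δ = δ} δ≤0 _ = (λ _ → 1≤1-δ) , (λ _ → 1≤1-δ)
  where
  1≤1-δ : 1ℚ ≤ 1ℚ - δ
  1≤1-δ = 0≤q-p⇒p≤q (subst (0ℚ ≤_) (solve 1 (λ δ → :- δ := (con 1ℚ :- δ) :- con 1ℚ) refl δ)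
                                  (neg-antimono-≤ δ≤0))

mainTheorem7 : ∃[ C ] ((M k : ℕ) → 2 ℕ.≤ M → (δ : ℚ) → δ * (+ (M ℕ.* M) / 1) ≤ 1ℚ →
    ∃[ p ] (DegreeAtMost {M ℕ.* k} p (C ℕ.* k) × ApproxED {M} {k} p (1ℚ - δ)))
mainTheorem7 = 2 , construction
  where
  construction : (M k : ℕ) → 2 ℕ.≤ M → (δ : ℚ) → δ * fromℕ (M ℕ.* M) ≤ 1ℚ →
    ∃[ p ] (DegreeAtMost {M ℕ.* k} p (2 ℕ.* k) × ApproxED {M} {k} p (1ℚ - δ))
  construction M k 2≤M δ δM²≤1 with δ ≤? 0ℚ
  ... | yes δ≤0 = [] , All.[] , zeroPoly-approximates δ≤0
  ... | no  δ≰0 = edPoly M k δ , degree-edPoly M k δ ,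
                  edPoly-approximates (ℕₚ.≤-trans (ℕₚ.n≤1+n 1) 2≤M) (<⇒≤ (≰⇒> δ≰0)) δM²≤1
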